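{- Let $A$ and $B$ be sets, let $M\subseteq A^A$ and $M'\subseteq B^B$ be transformation monoids, and suppose that $M$ has a subset $G$ consisting of invertible elements of $M$ such that $G$ is dense in $M$. Let $\xi\colon M\to M'$ be a monoid homomorphism that is continuous. Then $\xi$ is uniformly continuous.
   Context: A transformation monoid on a set $A$ is a subset of $A^A$ containing $\mathrm{id}_A$ and closed under composition $\circ$. An element $g\in M$ is invertible in $M$ if there is $h\in M$ with $g\circ h=h\circ g=\mathrm{id}_A$. Subsets of $A^A$ carry the topology of pointwise convergence (product topology with $A$ discrete) and the associated uniformity whose basic entourages are $\{(f_1,f_2)\in F^2 : f_1\restriction_C=f_2\restriction_C\}$ for finite $C\subseteq A$. Thus $\xi\colon M\to M'$ is uniformly continuous iff for every finite $D\subseteq B$ there is a finite $C\subseteq A$ such that for all $f_1,f_2\in M$, $f_1\restriction_C=f_2\restriction_C$ implies $\xi(f_1)\restriction_D=\xi(f_2)\restriction_D$. -}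

module Defs where

open import Level using (0ℓ)
open import Data.List using (List)
open import Data.List.Relation.Unary.All using (All)
open import Data.Product using (Σ; ∃; ∃-syntax; _×_; _,_; proj₁; proj₂)
open import Relation.Binary.PropositionalEquality using (_≡_)
open import Relation.Unary using (Pred; _∈_)
open import Function using (_∘_; id)

-- Maps agree on a finite subset C ⊆ A (finite subsets represented by lists).
_≡on_∣_ : {A X : Set} → (A → X) → List A → (A → X) → Set
f ≡on C ∣ g = All (λ a → f a ≡ g a) C

_≐_ : {A : Set} → (A → A) → (A → A) → Set
f ≐ g = ∀ a → f a ≡ g a

record TransformationMonoid (A : Set) : Set₁ where
  field
    member  : Pred (A → A) 0ℓ
    id∈     : member id
    ∘-closed : ∀ {f g} → member f → member g → member (f ∘ g)

  Elt : Set
  Elt = Σ (A → A) member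

open TransformationMonoid public

Invertible : {A : Set} (M : TransformationMonoid A) → (A → A) → Set
Invertible M g = ∃[ h ] (member M h × (g ∘ h) ≐ id × (h ∘ g) ≐ id)

-- G ⊆ M is dense in M (topology of pointwise convergence):
-- every basic neighbourhood { f' ∈ M : f' ↾ C = f ↾ C } of f ∈ M meets G.
Dense : {A : Set} (M : TransformationMonoid A) → Pred (A → A) 0ℓ → Set
Dense {A} M G = (f : Elt M) (C : List A) → ∃[ g ] (G g × member M g × g ≡on C ∣ proj₁ f)

IsMonoidHom : {A B : Set} (M : TransformationMonoid A) (M' : TransformationMonoid B)
              → (Elt M → Elt M') → Set
IsMonoidHom M M' ξ =
    (proj₁ (ξ (id , id∈ M)) ≐ id)
  × (∀ (f g : Elt M) →
       proj₁ (ξ (proj₁ f ∘ proj₁ g , ∘-closed M (proj₂ f) (proj₂ g)))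
         ≐ (proj₁ (ξ f) ∘ proj₁ (ξ g)))

Continuous : {A B : Set} (M : TransformationMonoid A) (M' : TransformationMonoid B)
             → (Elt M → Elt M') → Set
Continuous {A} {B} M M' ξ =
  (f : Elt M) (D : List B) → ∃[ C ] ((g : Elt M) →
     proj₁ g ≡on C ∣ proj₁ f → proj₁ (ξ g) ≡on D ∣ proj₁ (ξ f))

UniformlyContinuous : {A B : Set} (M : TransformationMonoid A) (M' : TransformationMonoid B)
                      → (Elt M → Elt M') → Set
UniformlyContinuous {A} {B} M M' ξ =
  (D : List B) → ∃[ C ] ((f₁ f₂ : Elt M) →
     proj₁ f₁ ≡on C ∣ proj₁ f₂ → proj₁ (ξ f₁) ≡on D ∣ proj₁ (ξ f₂))

module Submission where

-- Uniform continuity reduces to continuity at the identity e,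
-- transported along the dense set G of invertible elements.  Given a finite
-- D ⊆ B, let C ⊆ A witness continuity of ξ at e for D.  If f₁ and f₂ agree on
-- C, density supplies g ∈ G agreeing with f₂ (hence also with f₁) on C.  For
-- the inverse h of g and any f agreeing with g on C, the map h ∘ f agrees with
-- id on C, so ξ(h)∘ξ(f) = ξ(h ∘ f) agrees with ξ(e) = id on D; applying ξ(g),
-- which is a left inverse of ξ(h), gives ξ(f) = ξ(g) on D.  Thus ξ(f₁) and
-- ξ(f₂) both agree with ξ(g) on D.

open import Defs
open import Relation.Unary using (Pred; _⊆_)
open import Level using (0ℓ)
open import Data.List using (List; []; _∷_)
open import Data.List.Relation.Unary.All as All using (All; []; _∷_)
open import Data.Product using (_,_; proj₁; proj₂)
open import Relation.Binary.PropositionalEquality using (_≡_; sym; trans; cong)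
open import Function using (_∘_; id)

module _ {A X : Set} where

  ≡on-sym : {C : List A} {f g : A → X} → f ≡on C ∣ g → g ≡on C ∣ f
  ≡on-sym = All.map sym

  ≡on-trans : {C : List A} {f g k : A → X} → f ≡on C ∣ g → g ≡on C ∣ k → f ≡on C ∣ k
  ≡on-trans p q = All.zipWith (λ (x , y) → trans x y) (p , q)

  ≡on-∘ : {Y : Set} (h : X → Y) {C : List A} {f g : A → X} →
          f ≡on C ∣ g → (h ∘ f) ≡on C ∣ (h ∘ g)
  ≡on-∘ h = All.map (cong h)

≐⇒≡on : {A : Set} {f g : A → A} → f ≐ g → (C : List A) → f ≡on C ∣ g
≐⇒≡on f≐g = All.universal f≐g

module MonoidOps {A : Set} (M : TransformationMonoid A) where

  _·_ : Elt M → Elt M → Elt M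
  (f , f∈) · (g , g∈) = f ∘ g , ∘-closed M f∈ g∈

  e : Elt M
  e = id , id∈ M

module _ {A B : Set} (M : TransformationMonoid A) (M' : TransformationMonoid B) where

  open MonoidOps M

  -- A continuous map respects pointwise equality: to compare ξ f and ξ g at b,
  -- use continuity at g for the one-point set [b].
  continuous⇒extensional : (ξ : Elt M → Elt M') → Continuous M M' ξ →
                           (f g : Elt M) → proj₁ f ≐ proj₁ g → proj₁ (ξ f) ≐ proj₁ (ξ g)
  continuous⇒extensional ξ cont f g f≐g b with cont g (b ∷ [])
  ... | C , near-g with near-g f (≐⇒≡on f≐g C)
  ...   | ξf≡ξg ∷ [] = ξf≡ξg

  hom-right-inverse : (ξ : Elt M → Elt M') → IsMonoidHom M M' ξ → Continuous M M' ξ →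
                      (g h : Elt M) → (proj₁ g ∘ proj₁ h) ≐ id →
                      (proj₁ (ξ g) ∘ proj₁ (ξ h)) ≐ id
  hom-right-inverse ξ (ξe≐id , ξ·) cont g h gh≐id b =
    trans (sym (ξ· g h b))
          (trans (continuous⇒extensional ξ cont (g · h) e gh≐id b) (ξe≐id b))

  agrees-near-invertible :
    (ξ : Elt M → Elt M') → IsMonoidHom M M' ξ → Continuous M M' ξ →
    {C : List A} {D : List B} →
    ((k : Elt M) → proj₁ k ≡on C ∣ id → proj₁ (ξ k) ≡on D ∣ proj₁ (ξ e)) →
    (g : Elt M) → Invertible M (proj₁ g) →
    (f : Elt M) → proj₁ f ≡on C ∣ proj₁ g → proj₁ (ξ f) ≡on D ∣ proj₁ (ξ g)
  agrees-near-invertible ξ isHom@(ξe≐id , ξ·) cont {C} near-e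
                         g (h , h∈ , gh≐id , hg≐id) f f≡g =
    All.map ξf≡ξg (near-e (h′ · f) hf≡id)
    where
    h′ : Elt M
    h′ = h , h∈

    hf≡id : (h ∘ proj₁ f) ≡on C ∣ id
    hf≡id = ≡on-trans (≡on-∘ h f≡g) (≐⇒≡on hg≐id C)

    -- From ξ(h ∘ f) d = ξ(e) d, cancel ξ h on the left using ξ g ∘ ξ h = id.
    ξf≡ξg : ∀ {d} → proj₁ (ξ (h′ · f)) d ≡ proj₁ (ξ e) d → proj₁ (ξ f) d ≡ proj₁ (ξ g) d
    ξf≡ξg {d} ξhf≡ξe =
      trans (sym (hom-right-inverse ξ isHom cont g h′ gh≐id (proj₁ (ξ f) d)))
            (cong (proj₁ (ξ g))
                  (trans (sym (ξ· h′ f d)) (trans ξhf≡ξe (ξe≐id d))))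

lemma3p1 : (A B : Set) (M : TransformationMonoid A) (M' : TransformationMonoid B)
    (G : Pred (A → A) 0ℓ)
    → G ⊆ member M
    → (∀ {g} → G g → Invertible M g)
    → Dense M G
    → (ξ : Elt M → Elt M')
    → IsMonoidHom M M' ξ
    → Continuous M M' ξ
    → UniformlyContinuous M M' ξ
lemma3p1 A B M M' G _ invertible dense ξ isHom cont D = C , uniform
  where
  open MonoidOps M using (e)

  C : List A
  C = proj₁ (cont e D)

  uniform : (f₁ f₂ : Elt M) → proj₁ f₁ ≡on C ∣ proj₁ f₂ → proj₁ (ξ f₁) ≡on D ∣ proj₁ (ξ f₂)
  uniform f₁ f₂ f₁≡f₂ with dense f₂ C
  ... | g , g∈G , g∈M , g≡f₂ =
    ≡on-trans (near-g f₁ (≡on-trans f₁≡f₂ (≡on-sym g≡f₂)))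
              (≡on-sym (near-g f₂ (≡on-sym g≡f₂)))
    where
    near-g : (f : Elt M) → proj₁ f ≡on C ∣ g → proj₁ (ξ f) ≡on D ∣ proj₁ (ξ (g , g∈M))
    near-g = agrees-near-invertible M M' ξ isHom cont
               (proj₂ (cont e D)) (g , g∈M) (invertible g∈G)
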